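{- Let $p$ be a prime, $m>1$ an integer with $p\nmid m$, and $0<i<m$ an integer. For every $n\ge 0$ and every integer $a$ with $0\le a<p^n$, put \[ \mu\big(\tfrac{i}{m}\big)(a+p^n\mathbb{Z}_p):=\frac{[ip^{ -n}]_m}{m}+\delta_n(a). \] Then this function on the sets $a+p^n\mathbb{Z}_p$ is a ($\mathbb{Z}_p$-valued) measure on $\mathbb{Z}_p$; that is, for all $n\ge 0$ and $0\le a<p^n$, \[ \mu\big(\tfrac{i}{m}\big)(a+p^n\mathbb{Z}_p)=\sum_{b=0}^{p-1}\mu\big(\tfrac{i}{m}\big)(a+bp^n+p^{n+1}\mathbb{Z}_p), \] so that it extends uniquely to a finitely additive $\mathbb{Z}_p$-valued function on compact open subsets of $\mathbb{Z}_p$.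
   Context: For a nonzero rational number $k=a/b$ with $a,b\in\mathbb{Z}$ and $\gcd(b,m)=1$, $[k]_m$ denotes the unique integer with $0\le [k]_m<m$ and $b[k]_m\equiv a \pmod m$. Define integers $k_\alpha(i)$, $\alpha\ge 0$, by the equalities $p\,[ip^{ -r}]_m=[ip^{ -(r-1)}]_m+k_{r-1}(i)\,m$ for $r\ge 1$ (one has $0\le k_\alpha(i)\le p-1$). For $n\ge0$ and an integer $0\le a<p^n$ set $\delta_n(a)=-1$ if $a\ge 1+\sum_{\alpha=0}^{n-1}(p-1-k_\alpha(i))p^\alpha$, and $\delta_n(a)=0$ otherwise (an empty sum is $0$). -}

module Defs where

open import Data.Bool using (Bool; true; false; if_then_else_)
open import Data.Nat using (ℕ; zero; suc; _+_; _*_; _∸_; _^_; _<ᵇ_; NonZero)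
open import Data.Nat.DivMod using (_%_; _/_)
open import Data.Nat.Properties using (_≟_)
open import Data.Integer using (ℤ; +_; -[1+_])
open import Data.Rational using (ℚ; 0ℚ) renaming (_+_ to _+ℚ_; _/_ to _/ℚ_)
open import Relation.Nullary.Decidable using (⌊_⌋)

-- first x in [k, k+fuel) with f x = true; 0 if none
search : (ℕ → Bool) → ℕ → ℕ → ℕ
search f k zero = 0
search f k (suc fuel) = if f k then k else search f (suc k) fuel

-- [ i p^{-r} ]_m : the unique 0 ≤ x < m with p^r x ≡ i (mod m)
-- (exists and is unique when gcd(p,m)=1; found by search over 0..m-1)
brk : (p m i r : ℕ) → .{{NonZero m}} → ℕ
brk p m i r = search (λ x → ⌊ ((p ^ r) * x) % m ≟ i % m ⌋) 0 m

-- k_α(i), defined by p [i p^{-(α+1)}]_m = [i p^{-α}]_m + k_α(i) m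
kdig : (p m i α : ℕ) → .{{NonZero m}} → ℕ
kdig p m i α = (p * brk p m i (suc α) ∸ brk p m i α) / m

sumℕ : ℕ → (ℕ → ℕ) → ℕ
sumℕ zero f = 0
sumℕ (suc n) f = sumℕ n f + f n

sumℚ : ℕ → (ℕ → ℚ) → ℚ
sumℚ zero f = 0ℚ
sumℚ (suc n) f = sumℚ n f +ℚ f n

threshold : (p m i n : ℕ) → .{{NonZero m}} → ℕ
threshold p m i n = 1 + sumℕ n (λ α → (p ∸ 1 ∸ kdig p m i α) * p ^ α)

δ : (p m i n a : ℕ) → .{{NonZero m}} → ℤ
δ p m i n a = if a <ᵇ threshold p m i n then + 0 else -[1+ 0 ]

μ : (p m i n a : ℕ) → .{{NonZero m}} → ℚ
μ p m i n a = ((+ brk p m i n) /ℚ m) +ℚ (δ p m i n a /ℚ 1)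

module Submission where

-- Writing x = [i p⁻ⁿ]_m, y = [i p⁻⁽ⁿ⁺¹⁾]_m and k = kₙ(i), we put both sides over the
-- common denominator m.  The left numerator is x + δₙ(a)·m, the right one is
-- p·y + (Σ_b δₙ₊₁(a + b pⁿ))·m.  Since p·y = x + k·m (the defining relation of the
-- digit k), the theorem reduces to the counting identity
--     δₙ(a) = k + Σ_{b<p} δₙ₊₁(a + b pⁿ).                                    (★)
-- The thresholds satisfy Tₙ₊₁ = Tₙ + (p-1-k)·pⁿ and Tₙ ≤ pⁿ, so δₙ₊₁(a + b pⁿ) jumps
-- from 0 to -1 at b = p-k (if a < Tₙ) or at b = p-1-k (if a ≥ Tₙ); counting the -1's
-- gives (★).

open import Defs
open import Data.Nat using (ℕ; zero; suc; _+_; _*_; _∸_; _^_; _<_; _≤_; _<ᵇ_; NonZero; z≤n; z<s)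
open import Data.Nat.Properties
open import Data.Nat.DivMod using (_%_; _/_; %-distribˡ-*; m%n%n≡m%n; [m+kn]%n≡m%n; m<n⇒m%n≡m; m≡m%n+[m/n]*n; m*n/n≡m; m%n<n)
open import Data.Nat.Divisibility using (_∣_)
open import Data.Nat.Primality using (Prime; prime⇒irreducible; prime⇒nonZero)
open import Data.Nat.Coprimality using (Coprime; coprime-Bézout)
open import Data.Nat.GCD using (module Bézout)
import Data.Nat.Solver as ℕ-Solver
open import Data.Integer as ℤ using (ℤ; +_; -[1+_])
import Data.Integer.Properties as ℤP
import Data.Integer.Solver as ℤ-Solver
open import Data.Rational using (ℚ; fromℚᵘ) renaming (_+_ to _+ℚ_; _/_ to _/ℚ_)
open import Data.Rational.Properties using (toℚᵘ-injective; toℚᵘ-fromℚᵘ; toℚᵘ-homo-+; fromℚᵘ-cong)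
open import Data.Rational.Unnormalised using (mkℚᵘ; *≡*) renaming (_+_ to _+ᵘ_)
open import Data.Rational.Unnormalised.Properties using (≃-trans; ≃-sym) renaming (+-cong to +ᵘ-cong)
open import Data.Bool using (Bool; true; false; T; if_then_else_)
open import Data.Unit using (tt)
open import Data.Product using (∃; _×_; _,_; proj₁; proj₂)
open import Data.Sum using (inj₁; inj₂)
open import Data.Empty using (⊥-elim)
open import Relation.Nullary using (¬_; yes; no; contradiction)
open import Relation.Nullary.Reflects using (ofʸ; ofⁿ)
open import Relation.Nullary.Decidable using (⌊_⌋; toWitness; fromWitness)
open import Relation.Binary.PropositionalEquality
open ≡-Reasoning

fromℚᵘ-homo-+ : ∀ u v → fromℚᵘ u +ℚ fromℚᵘ v ≡ fromℚᵘ (u +ᵘ v)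
fromℚᵘ-homo-+ u v = toℚᵘ-injective
  (≃-trans (toℚᵘ-homo-+ (fromℚᵘ u) (fromℚᵘ v))
  (≃-trans (+ᵘ-cong (toℚᵘ-fromℚᵘ u) (toℚᵘ-fromℚᵘ v))
           (≃-sym (toℚᵘ-fromℚᵘ (u +ᵘ v)))))

/-cross : ∀ (a b : ℤ) d e .{{_ : NonZero d}} .{{_ : NonZero e}} →
          a ℤ.* + e ≡ b ℤ.* + d → a /ℚ d ≡ b /ℚ e
/-cross a b (suc d) (suc e) eq = fromℚᵘ-cong {mkℚᵘ a d} {mkℚᵘ b e} (*≡* eq)

/-+-/ : ∀ (a b : ℤ) d .{{_ : NonZero d}} → (a /ℚ d) +ℚ (b /ℚ d) ≡ (a ℤ.+ b) /ℚ d
/-+-/ a b (suc d) = trans (fromℚᵘ-homo-+ (mkℚᵘ a d) (mkℚᵘ b d)) (/-cross (a ℤ.* D ℤ.+ b ℤ.* D) (a ℤ.+ b) (suc d * suc d) (suc d) cross)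
  where
  open ℤ-Solver.+-*-Solver
  D : ℤ
  D = + suc d
  cross : (a ℤ.* D ℤ.+ b ℤ.* D) ℤ.* D ≡ (a ℤ.+ b) ℤ.* + (suc d * suc d)
  cross = trans (solve 3 (λ a b D → (a :* D :+ b :* D) :* D := (a :+ b) :* (D :* D)) refl a b D)
                (cong ((a ℤ.+ b) ℤ.*_) (sym (ℤP.pos-* (suc d) (suc d))))

/-+-integer : ∀ (a b : ℤ) d .{{_ : NonZero d}} → (a /ℚ d) +ℚ (b /ℚ 1) ≡ (a ℤ.+ b ℤ.* + d) /ℚ d
/-+-integer a b (suc d) = trans (fromℚᵘ-homo-+ (mkℚᵘ a d) (mkℚᵘ b 0)) (/-cross (a ℤ.* + 1 ℤ.+ b ℤ.* D) (a ℤ.+ b ℤ.* D) (suc d * 1) (suc d) cross)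
  where
  open ℤ-Solver.+-*-Solver
  D : ℤ
  D = + suc d
  cross : (a ℤ.* + 1 ℤ.+ b ℤ.* D) ℤ.* D ≡ (a ℤ.+ b ℤ.* D) ℤ.* + (suc d * 1)
  cross = trans (solve 3 (λ a b D → (a :* con (+ 1) :+ b :* D) :* D := (a :+ b :* D) :* (D :* con (+ 1))) refl a b D)
                (cong ((a ℤ.+ b ℤ.* D) ℤ.*_) (sym (ℤP.pos-* (suc d) 1)))

sumℤ : ℕ → (ℕ → ℤ) → ℤ
sumℤ zero    f = + 0
sumℤ (suc n) f = sumℤ n f ℤ.+ f n

sumℚ-cong : ∀ k {f g : ℕ → ℚ} → (∀ b → f b ≡ g b) → sumℚ k f ≡ sumℚ k g
sumℚ-cong zero    f≡g = refl
sumℚ-cong (suc k) f≡g = cong₂ _+ℚ_ (sumℚ-cong k f≡g) (f≡g k)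

sumℚ-/ : ∀ k (c : ℕ → ℤ) d .{{_ : NonZero d}} → sumℚ k (λ b → c b /ℚ d) ≡ sumℤ k c /ℚ d
sumℚ-/ zero    c d = /-cross (+ 0) (+ 0) 1 d refl
sumℚ-/ (suc k) c d = trans (cong (_+ℚ (c k /ℚ d)) (sumℚ-/ k c d)) (/-+-/ (sumℤ k c) (c k) d)

sumℤ-affine : ∀ k (y c : ℤ) (g : ℕ → ℤ) → sumℤ k (λ b → y ℤ.+ g b ℤ.* c) ≡ + k ℤ.* y ℤ.+ sumℤ k g ℤ.* c
sumℤ-affine zero    y c g = solve 2 (λ y c → con (+ 0) := con (+ 0) :* y :+ con (+ 0) :* c) refl y c
  where open ℤ-Solver.+-*-Solver
sumℤ-affine (suc k) y c g = begin
  sumℤ k (λ b → y ℤ.+ g b ℤ.* c) ℤ.+ (y ℤ.+ g k ℤ.* c)  ≡⟨ cong (ℤ._+ (y ℤ.+ g k ℤ.* c)) (sumℤ-affine k y c g) ⟩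
  (+ k ℤ.* y ℤ.+ S ℤ.* c) ℤ.+ (y ℤ.+ g k ℤ.* c)         ≡⟨ solve 5 (λ K y S G c → (K :* y :+ S :* c) :+ (y :+ G :* c) := (con (+ 1) :+ K) :* y :+ (S :+ G) :* c) refl (+ k) y S (g k) c ⟩
  + suc k ℤ.* y ℤ.+ (S ℤ.+ g k) ℤ.* c                   ∎
  where
  open ℤ-Solver.+-*-Solver
  S : ℤ
  S = sumℤ k g

infix 4 _≡_[mod_]
_≡_[mod_] : ℕ → ℕ → (m : ℕ) → .{{NonZero m}} → Set
x ≡ y [mod m ] = x % m ≡ y % m

module _ {m : ℕ} .{{_ : NonZero m}} where

  %-≡-mod : ∀ a → a % m ≡ a [mod m ]
  %-≡-mod a = m%n%n≡m%n a m

  *-congˡ-mod : ∀ k {a b} → a ≡ b [mod m ] → k * a ≡ k * b [mod m ]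
  *-congˡ-mod k {a} {b} a≡b = begin
    (k * a) % m                ≡⟨ %-distribˡ-* k a m ⟩
    ((k % m) * (a % m)) % m    ≡⟨ cong (λ z → ((k % m) * z) % m) a≡b ⟩
    ((k % m) * (b % m)) % m    ≡⟨ %-distribˡ-* k b m ⟨
    (k * b) % m                ∎

  *-congʳ-mod : ∀ k {a b} → a ≡ b [mod m ] → a * k ≡ b * k [mod m ]
  *-congʳ-mod k {a} {b} a≡b rewrite *-comm a k | *-comm b k = *-congˡ-mod k a≡b

  unit-^ : ∀ c u r → c * u ≡ 1 [mod m ] → c ^ r * u ^ r ≡ 1 [mod m ]
  unit-^ c u zero    cu = refl
  unit-^ c u (suc r) cu = begin
    (c * c ^ r * (u * u ^ r)) % m   ≡⟨ cong (_% m) ([m*n]*[o*p]≡[m*o]*[n*p] c (c ^ r) u (u ^ r)) ⟩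
    (c * u * (c ^ r * u ^ r)) % m   ≡⟨ *-congʳ-mod (c ^ r * u ^ r) cu ⟩
    (1 * (c ^ r * u ^ r)) % m       ≡⟨ cong (_% m) (*-identityˡ (c ^ r * u ^ r)) ⟩
    (c ^ r * u ^ r) % m             ≡⟨ unit-^ c u r cu ⟩
    1 % m                           ∎

  unit-cancel : ∀ c u {s t} → c * u ≡ 1 [mod m ] → c * s ≡ c * t [mod m ] → s < m → t < m → s ≡ t
  unit-cancel c u {s} {t} cu cs≡ct s<m t<m = begin
    s                  ≡⟨ m<n⇒m%n≡m s<m ⟨
    s % m              ≡⟨ undo s ⟩
    (u * (c * s)) % m  ≡⟨ *-congˡ-mod u cs≡ct ⟩
    (u * (c * t)) % m  ≡⟨ undo t ⟨
    t % m              ≡⟨ m<n⇒m%n≡m t<m ⟩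
    t                  ∎
    where
    undo : ∀ x → x ≡ u * (c * x) [mod m ]
    undo x = begin
      x % m              ≡⟨ cong (_% m) (*-identityˡ x) ⟨
      (1 * x) % m        ≡⟨ *-congʳ-mod x (trans (sym cu) (cong (_% m) (*-comm c u))) ⟩
      (u * c * x) % m    ≡⟨ cong (_% m) (*-assoc u c x) ⟩
      (u * (c * x)) % m  ∎

prime-unit : ∀ {p} m .{{_ : NonZero m}} → Prime p → ¬ (p ∣ m) → ∃ λ u → p * u ≡ 1 [mod m ]
prime-unit {p} (suc d) p-prime p∤m with coprime-Bézout p⊥m
  where
  p⊥m : Coprime p (suc d)
  p⊥m (e∣p , e∣m) with prime⇒irreducible p-prime e∣p
  ... | inj₁ e≡1 = e≡1
  ... | inj₂ refl = ⊥-elim (p∤m e∣m)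
... | Bézout.+- x y 1+ym≡xp = x , (begin
  (p * x) % suc d            ≡⟨ cong (_% suc d) (trans (*-comm p x) (sym 1+ym≡xp)) ⟩
  (1 + y * suc d) % suc d    ≡⟨ [m+kn]%n≡m%n 1 y (suc d) ⟩
  1 % suc d                  ∎)
... | Bézout.-+ x y 1+xp≡ym = x * d , (begin
  (p * (x * d)) % suc d                ≡⟨ [m+kn]%n≡m%n (p * (x * d)) y (suc d) ⟨
  (p * (x * d) + y * suc d) % suc d    ≡⟨ cong (_% suc d) key ⟩
  (1 + p * x * suc d) % suc d          ≡⟨ [m+kn]%n≡m%n 1 (p * x) (suc d) ⟩
  1 % suc d                            ∎)
  where
  open ℕ-Solver.+-*-Solver
  -- x·p ≡ -1, so p·(x·(m-1)) ≡ 1 modulo m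
  key : p * (x * d) + y * suc d ≡ 1 + p * x * suc d
  key = trans (cong (λ z → p * (x * d) + z) (sym 1+xp≡ym))
              (solve 3 (λ p x d → p :* (x :* d) :+ (con 1 :+ x :* p) := con 1 :+ p :* x :* (con 1 :+ d)) refl p x d)

search-sound : ∀ (f : ℕ → Bool) k fuel w → k ≤ w → w < k + fuel → T (f w) →
               T (f (search f k fuel)) × search f k fuel < k + fuel
search-sound f k zero w k≤w w<k+0 fw = contradiction (subst (_≤ w) (sym (+-identityʳ k)) k≤w) (<⇒≱ w<k+0)
search-sound f k (suc fuel) w k≤w w<end fw with f k in fk
... | true  = subst T (sym fk) tt , m<m+n k z<s
... | false with k ≟ w
...   | yes refl = contradiction (subst T fk fw) λ ()
...   | no k≢w   with search-sound f (suc k) fuel w (≤∧≢⇒< k≤w k≢w) (subst (w <_) (+-suc k fuel) w<end) fw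
...     | found , in-range = found , subst (search f (suc k) fuel <_) (sym (+-suc k fuel)) in-range

module Digits (p' m i : ℕ) .{{_ : NonZero m}} (u : ℕ) (p-unit : suc p' * u ≡ 1 [mod m ]) where

  private
    p : ℕ
    p = suc p'

  -- [i p⁻ʳ]_m is a residue solving pʳ·x ≡ i; the search succeeds since (uʳ i mod m) is a solution.
  brk-spec : ∀ r → brk p m i r < m × p ^ r * brk p m i r ≡ i [mod m ]
  brk-spec r with search-sound (λ x → ⌊ (p ^ r * x) % m ≟ i % m ⌋) 0 m w z≤n (m%n<n (u ^ r * i) m) (fromWitness w-solves)
    where
    w : ℕ
    w = (u ^ r * i) % m
    w-solves : p ^ r * w ≡ i [mod m ]
    w-solves = begin
      (p ^ r * w) % m             ≡⟨ *-congˡ-mod (p ^ r) (%-≡-mod (u ^ r * i)) ⟩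
      (p ^ r * (u ^ r * i)) % m   ≡⟨ cong (_% m) (*-assoc (p ^ r) (u ^ r) i) ⟨
      (p ^ r * u ^ r * i) % m     ≡⟨ *-congʳ-mod i (unit-^ p u r p-unit) ⟩
      (1 * i) % m                 ≡⟨ cong (_% m) (*-identityˡ i) ⟩
      i % m                       ∎
  ... | solves , in-range = in-range , toWitness {a? = (p ^ r * brk p m i r) % m ≟ i % m} solves

  kdig-spec : ∀ n → p * brk p m i (suc n) ≡ brk p m i n + kdig p m i n * m × kdig p m i n < p
  kdig-spec n = digit-relation , digit<p
    where
    x y q : ℕ
    x = brk p m i n
    y = brk p m i (suc n)
    q = (p * y) / m
    -- p·y and x both solve pⁿ·z ≡ i, hence agree modulo m
    py%m≡x : (p * y) % m ≡ x
    py%m≡x = unit-cancel (p ^ n) (u ^ n) (unit-^ p u n p-unit) same-image (m%n<n (p * y) m) (proj₁ (brk-spec n))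
      where
      same-image : p ^ n * ((p * y) % m) ≡ p ^ n * x [mod m ]
      same-image = begin
        (p ^ n * ((p * y) % m)) % m  ≡⟨ *-congˡ-mod (p ^ n) (%-≡-mod (p * y)) ⟩
        (p ^ n * (p * y)) % m        ≡⟨ cong (_% m) (trans (sym (*-assoc (p ^ n) p y)) (cong (_* y) (*-comm (p ^ n) p))) ⟩
        (p ^ suc n * y) % m          ≡⟨ proj₂ (brk-spec (suc n)) ⟩
        i % m                        ≡⟨ proj₂ (brk-spec n) ⟨
        (p ^ n * x) % m              ∎
    division : p * y ≡ x + q * m
    division = trans (m≡m%n+[m/n]*n (p * y) m) (cong (_+ q * m) py%m≡x)
    kdig≡q : kdig p m i n ≡ q
    kdig≡q = begin
      (p * y ∸ x) / m      ≡⟨ cong (λ z → (z ∸ x) / m) division ⟩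
      (x + q * m ∸ x) / m  ≡⟨ cong (_/ m) (m+n∸m≡n x (q * m)) ⟩
      (q * m) / m          ≡⟨ m*n/n≡m q m ⟩
      q                    ∎
    digit-relation : p * y ≡ x + kdig p m i n * m
    digit-relation = trans division (cong (λ k → x + k * m) (sym kdig≡q))
    -- kₙ(i)·m ≤ p·y < p·m
    digit<p : kdig p m i n < p
    digit<p = *-cancelʳ-< m (kdig p m i n) p (≤-<-trans (m≤n+m (kdig p m i n * m) x)
                (subst (_< p * m) digit-relation (*-monoʳ-< p (proj₁ (brk-spec (suc n))))))

digits-bound : ∀ p' (c : ℕ → ℕ) → (∀ α → c α ≤ p') → ∀ n → sumℕ n (λ α → c α * suc p' ^ α) < suc p' ^ n
digits-bound p' c c≤p' zero    = z<s
digits-bound p' c c≤p' (suc n) = +-mono-<-≤ (digits-bound p' c c≤p' n) (*-monoˡ-≤ (suc p' ^ n) (c≤p' n))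

threshold-≤ : ∀ p' m i n .{{_ : NonZero m}} → threshold (suc p') m i n ≤ suc p' ^ n
threshold-≤ p' m i n = digits-bound p' (λ α → p' ∸ kdig (suc p') m i α) (λ α → m∸n≤m p' (kdig (suc p') m i α)) n

threshold-suc : ∀ p' m i n .{{_ : NonZero m}} →
                threshold (suc p') m i (suc n) ≡ threshold (suc p') m i n + (p' ∸ kdig (suc p') m i n) * suc p' ^ n
threshold-suc p' m i n = refl

<ᵇ-true : ∀ {a t} → a < t → (a <ᵇ t) ≡ true
<ᵇ-true {a} {t} a<t with a <ᵇ t | <ᵇ-reflects-< a t
... | true  | _       = refl
... | false | ofⁿ a≮t = contradiction a<t a≮t

<ᵇ-false : ∀ {a t} → t ≤ a → (a <ᵇ t) ≡ false
<ᵇ-false {a} {t} t≤a with a <ᵇ t | <ᵇ-reflects-< a t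
... | false | _       = refl
... | true  | ofʸ a<t = contradiction t≤a (<⇒≱ a<t)

δ-below : ∀ p m i n a .{{_ : NonZero m}} → a < threshold p m i n → δ p m i n a ≡ + 0
δ-below p m i n a a<T = cong (λ b → if b then + 0 else -[1+ 0 ]) (<ᵇ-true a<T)

δ-above : ∀ p m i n a .{{_ : NonZero m}} → threshold p m i n ≤ a → δ p m i n a ≡ -[1+ 0 ]
δ-above p m i n a T≤a = cong (λ b → if b then + 0 else -[1+ 0 ]) (<ᵇ-false T≤a)

step-sum : ∀ (g : ℕ → ℤ) t → (∀ b → b < t → g b ≡ + 0) → (∀ b → t ≤ b → g b ≡ -[1+ 0 ]) →
           ∀ k → sumℤ k g ≡ ℤ.- (+ (k ∸ t))
step-sum g t before after zero = cong (λ j → ℤ.- (+ j)) (sym (0∸n≡0 t))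
step-sum g t before after (suc k) with k <? t
... | yes k<t = begin
  sumℤ k g ℤ.+ g k          ≡⟨ cong₂ ℤ._+_ (step-sum g t before after k) (before k k<t) ⟩
  ℤ.- (+ (k ∸ t)) ℤ.+ + 0   ≡⟨ ℤP.+-identityʳ _ ⟩
  ℤ.- (+ (k ∸ t))           ≡⟨ cong (λ j → ℤ.- (+ j)) (trans (m≤n⇒m∸n≡0 (<⇒≤ k<t)) (sym (m≤n⇒m∸n≡0 k<t))) ⟩
  ℤ.- (+ (suc k ∸ t))       ∎
... | no k≮t = begin
  sumℤ k g ℤ.+ g k                ≡⟨ cong₂ ℤ._+_ (step-sum g t before after k) (after k t≤k) ⟩
  ℤ.- (+ (k ∸ t)) ℤ.+ -[1+ 0 ]    ≡⟨ solve 1 (λ j → :- j :+ :- con (+ 1) := :- (con (+ 1) :+ j)) refl (+ (k ∸ t)) ⟩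
  ℤ.- (+ suc (k ∸ t))             ≡⟨ cong (λ j → ℤ.- (+ j)) (+-∸-assoc 1 t≤k) ⟨
  ℤ.- (+ (suc k ∸ t))             ∎
  where
  open ℤ-Solver.+-*-Solver
  t≤k : t ≤ k
  t≤k = ≮⇒≥ k≮t

module Refinement (p' m i n : ℕ) .{{_ : NonZero m}} (k≤p' : kdig (suc p') m i n ≤ p') where

  private
    p P Tₙ k c : ℕ
    p = suc p'
    P = p ^ n
    Tₙ = threshold p m i n
    k = kdig p m i n
    c = p' ∸ k
    g : ℕ → ℕ → ℤ
    g a b = δ p m i (suc n) (a + b * P)

    next-below : ∀ x → x < Tₙ + c * P → δ p m i (suc n) x ≡ + 0
    next-below x x<T' = δ-below p m i (suc n) x (subst (x <_) (sym (threshold-suc p' m i n)) x<T')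

    next-above : ∀ x → Tₙ + c * P ≤ x → δ p m i (suc n) x ≡ -[1+ 0 ]
    next-above x T'≤x = δ-above p m i (suc n) x (subst (_≤ x) (sym (threshold-suc p' m i n)) T'≤x)

  -- If a < Tₙ, δₙ₊₁(a + b pⁿ) = -1 exactly for b ≥ p-k.
  refine-below : ∀ a → a < Tₙ → δ p m i n a ≡ + k ℤ.+ sumℤ p (g a)
  refine-below a a<Tₙ = begin
    δ p m i n a                    ≡⟨ δ-below p m i n a a<Tₙ ⟩
    + 0                            ≡⟨ ℤP.+-inverseʳ (+ k) ⟨
    + k ℤ.+ ℤ.- (+ k)              ≡⟨ cong (λ j → + k ℤ.+ ℤ.- (+ j)) (m∸[m∸n]≡n k≤p') ⟨
    + k ℤ.+ ℤ.- (+ (p ∸ suc c))    ≡⟨ cong (ℤ._+_ (+ k)) (step-sum (g a) (suc c) before after p) ⟨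
    + k ℤ.+ sumℤ p (g a)           ∎
    where
    before : ∀ b → b < suc c → g a b ≡ + 0
    before b b≤c = next-below (a + b * P) (+-mono-<-≤ a<Tₙ (*-monoˡ-≤ P (≤-pred b≤c)))
    after : ∀ b → suc c ≤ b → g a b ≡ -[1+ 0 ]
    after b c<b = next-above (a + b * P) (≤-trans (+-monoˡ-≤ (c * P) (threshold-≤ p' m i n))
                                   (≤-trans (*-monoˡ-≤ P c<b) (m≤n+m (b * P) a)))

  -- If Tₙ ≤ a < pⁿ, δₙ₊₁(a + b pⁿ) = -1 exactly for b ≥ p-1-k.
  refine-above : ∀ a → Tₙ ≤ a → a < P → δ p m i n a ≡ + k ℤ.+ sumℤ p (g a)
  refine-above a Tₙ≤a a<P = begin
    δ p m i n a                ≡⟨ δ-above p m i n a Tₙ≤a ⟩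
    -[1+ 0 ]                   ≡⟨ solve 1 (λ K → :- con (+ 1) := K :+ :- (con (+ 1) :+ K)) refl (+ k) ⟩
    + k ℤ.+ ℤ.- (+ suc k)      ≡⟨ cong (λ j → + k ℤ.+ ℤ.- (+ j)) p∸c≡1+k ⟨
    + k ℤ.+ ℤ.- (+ (p ∸ c))    ≡⟨ cong (ℤ._+_ (+ k)) (step-sum (g a) c before after p) ⟨
    + k ℤ.+ sumℤ p (g a)       ∎
    where
    open ℤ-Solver.+-*-Solver
    p∸c≡1+k : p ∸ c ≡ suc k
    p∸c≡1+k = trans (+-∸-assoc 1 (m∸n≤m p' k)) (cong suc (m∸[m∸n]≡n k≤p'))
    before : ∀ b → b < c → g a b ≡ + 0
    before b b<c = next-below (a + b * P) (<-≤-trans (+-monoˡ-< (b * P) a<P)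
                                      (≤-trans (*-monoˡ-≤ P b<c) (m≤n+m (c * P) Tₙ)))
    after : ∀ b → c ≤ b → g a b ≡ -[1+ 0 ]
    after b c≤b = next-above (a + b * P) (+-mono-≤ Tₙ≤a (*-monoˡ-≤ P c≤b))

  δ-refine : ∀ a → a < P → δ p m i n a ≡ + k ℤ.+ sumℤ p (g a)
  δ-refine a a<P with a <? Tₙ
  ... | yes a<Tₙ = refine-below a a<Tₙ
  ... | no  a≮Tₙ = refine-above a (≮⇒≥ a≮Tₙ) a<P

module Numerators (p' m i : ℕ) .{{_ : NonZero m}} (u : ℕ) (p-unit : suc p' * u ≡ 1 [mod m ]) where

  open Digits p' m i u p-unit

  private
    p : ℕ
    p = suc p'
    M : ℤ
    M = + m

  numerator-refine : ∀ n a → a < p ^ n →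
    + brk p m i n ℤ.+ δ p m i n a ℤ.* M ≡
    sumℤ p (λ b → + brk p m i (suc n) ℤ.+ δ p m i (suc n) (a + b * p ^ n) ℤ.* M)
  numerator-refine n a a<pⁿ = begin
    + x ℤ.+ δ p m i n a ℤ.* M        ≡⟨ cong (λ z → + x ℤ.+ z ℤ.* M) (δ-refine a a<pⁿ) ⟩
    + x ℤ.+ (+ k ℤ.+ S) ℤ.* M        ≡⟨ solve 4 (λ x k S M → x :+ (k :+ S) :* M := (x :+ k :* M) :+ S :* M) refl (+ x) (+ k) S M ⟩
    (+ x ℤ.+ + k ℤ.* M) ℤ.+ S ℤ.* M  ≡⟨ cong (ℤ._+ S ℤ.* M) p·y ⟨
    + p ℤ.* + y ℤ.+ S ℤ.* M          ≡⟨ sumℤ-affine p (+ y) M g ⟨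
    sumℤ p (λ b → + y ℤ.+ g b ℤ.* M) ∎
    where
    open ℤ-Solver.+-*-Solver
    open Refinement p' m i n (≤-pred (proj₂ (kdig-spec n)))
    x y k : ℕ
    x = brk p m i n
    y = brk p m i (suc n)
    k = kdig p m i n
    g : ℕ → ℤ
    g b = δ p m i (suc n) (a + b * p ^ n)
    S : ℤ
    S = sumℤ p g
    p·y : + p ℤ.* + y ≡ + x ℤ.+ + k ℤ.* M
    p·y = begin
      + p ℤ.* + y       ≡⟨ ℤP.pos-* p y ⟨
      + (p * y)         ≡⟨ cong +_ (proj₁ (kdig-spec n)) ⟩
      + (x + k * m)     ≡⟨ cong (ℤ._+_ (+ x)) (ℤP.pos-* k m) ⟩
      + x ℤ.+ + k ℤ.* M ∎

mainTheorem1 : (p m i : ℕ) → .{{_ : NonZero m}} → Prime p → 1 < m → ¬ (p ∣ m) → 0 < i → i < m →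
    (n a : ℕ) → a < p ^ n →
    μ p m i n a ≡ sumℚ p (λ b → μ p m i (suc n) (a + b * p ^ n))
mainTheorem1 zero m i p-prime = ⊥-elim (NonZero.nonZero (prime⇒nonZero p-prime))
mainTheorem1 p@(suc p') m i p-prime _ p∤m _ _ n a a<pⁿ = begin
  μ p m i n a                                                ≡⟨ /-+-integer (+ brk p m i n) (δ p m i n a) m ⟩
  (+ brk p m i n ℤ.+ δ p m i n a ℤ.* + m) /ℚ m               ≡⟨ cong (_/ℚ m) (numerator-refine n a a<pⁿ) ⟩
  sumℤ p N /ℚ m                                              ≡⟨ sumℚ-/ p N m ⟨
  sumℚ p (λ b → N b /ℚ m)                                    ≡⟨ sumℚ-cong p (λ b → /-+-integer (+ brk p m i (suc n)) (δ p m i (suc n) (a + b * p ^ n)) m) ⟨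
  sumℚ p (λ b → μ p m i (suc n) (a + b * p ^ n))             ∎
  where
  p-invertible : ∃ λ u → p * u ≡ 1 [mod m ]
  p-invertible = prime-unit m p-prime p∤m
  open Numerators p' m i (proj₁ p-invertible) (proj₂ p-invertible)
  N : ℕ → ℤ
  N b = + brk p m i (suc n) ℤ.+ δ p m i (suc n) (a + b * p ^ n) ℤ.* + m
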